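{- Let $s:\mathbb{Z}_{\ge 0}\to\mathbb{Z}_{\ge 0}$ be the sloping binary number function, $s(n)=\sum_{k\ge 0}\operatorname{bit}_k(n+k)\,2^k$. Then: (i) For every $n>0$ and every integer $m>\log_2 n$, $$ s(n) = 2^m - \tfrac12 - \tfrac12\sum_{k=0}^{m}(-1)^{\lfloor (n+k)/2^k\rfloor}\,2^k. $$ (ii) $s(0)=0$ and, for all integers $i\ge 0$ and $0\le j\le 2^i-1$, $$ s(2^i+j)=\begin{cases} 2^i+s(j) & \text{if } j\neq 2^i-i-1,\\ 3\cdot 2^i+s(j) & \text{if } j=2^i-i-1.\end{cases} $$ (iii) For all $n\ge 0$, $$ s(n)= n+\sum_{k\ge 1,\; n+k\equiv 0 \pmod{2^k}} 2^k. $$ (iv) The values $s(n)$, $n\ge 0$, are pairwise distinct, and $s(n)\ge n$ for all $n\ge 0$.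
   Context: For integers $m\ge 0$ and $k\ge 0$, let $\operatorname{bit}_k(m)=\lfloor m/2^k\rfloor \bmod 2$ denote the coefficient of $2^k$ in the binary expansion of $m$. For $n\ge 0$ define $s(n)=\sum_{k\ge 0}\operatorname{bit}_k(n+k)\,2^k$ (a finite sum, since $\operatorname{bit}_k(n+k)=0$ once $n+k<2^k$). Equivalently, $s(n)$ is obtained by writing the binary expansions of $0,1,2,\dots$ right-justified one per row and reading along the diagonal that starts at the units digit of row $n$ and slopes upward to the right-to-left, i.e. the $2^k$ digit of $s(n)$ is the $2^k$ digit of $n+k$. The first values are $0,3,6,5,4,15,10,9,8,11,\dots$. -}

module Defs where

open import Data.Nat using (ℕ; zero; suc; _+_; _*_; _^_; _%_; _/_)
open import Data.Nat.Properties using (m^n≢0)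
open import Data.Nat.Divisibility using (_∣?_)
open import Data.List using (List; map; upTo; foldr)
open import Data.Nat.ListAction using (sum)
open import Data.Integer as ℤ using (ℤ)
open import Relation.Nullary.Decidable using (does)
open import Data.Bool using (if_then_else_)

_/2^_ : ℕ → ℕ → ℕ
m /2^ k = _/_ m (2 ^ k) {{m^n≢0 2 k}}

bit : ℕ → ℕ → ℕ
bit k m = (m /2^ k) % 2

Σ<ℕ : ℕ → (ℕ → ℕ) → ℕ
Σ<ℕ N f = sum (map f (upTo N))

Σ<ℤ : ℕ → (ℕ → ℤ) → ℤ
Σ<ℤ N f = foldr ℤ._+_ (ℤ.+ 0) (map f (upTo N))

-- The sloping binary number s(n) = Σ_{k ≥ 0} bit_k(n+k) 2^k.
-- All terms with k ≥ n+2 vanish (n+k < 2^k there), so the sum over k < n+2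
-- is the full (finite) sum.
s : ℕ → ℕ
s n = Σ<ℕ (n + 2) (λ k → bit k (n + k) * 2 ^ k)

negOnePow : ℕ → ℤ
negOnePow e = if does ((e % 2) Data.Nat.≟ 0) then ℤ.+ 1 else ℤ.- (ℤ.+ 1)

-- Σ_{k ≥ 1, 2^k ∣ n+k} 2^k.  Terms with k ≥ n+2 cannot occur since then
-- 0 < n+k < 2^k, so summing over 1 ≤ k ≤ n+1 is the full (finite) sum.
divSum : ℕ → ℕ
divSum n = Σ<ℕ (n + 2) (λ k → term k)
  where
  term : ℕ → ℕ
  term zero = 0
  term (suc k') = if does ((2 ^ suc k') ∣? (n + suc k')) then 2 ^ suc k' else 0

{-# OPTIONS --safe #-}
-- Put d k = ⌊(n + k) / 2^k⌋, so that the k-th digit of s n is d k mod 2. Since ⌊(x + 1) / q⌋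
-- exceeds ⌊x / q⌋ exactly when q ∣ x + 1, we get d (k + 1) = ⌊d k / 2⌋ + [2^(k+1) ∣ n + k + 1],
-- and the partial sums of s n telescope:
--   Σ_{k<N} (d k mod 2) 2^k + d N 2^N = n + Σ_{1≤k≤N} [2^k ∣ n + k] 2^k,
-- where d N = 0 as soon as n + N < 2^N. This is (iii). Part (ii) follows by comparing these
-- divisibility terms for 2^i + j and for j, which agree except at k = i + 1, and (i) is the
-- binary expansion of s n with each digit b recoded as the sign (-1)^b = 1 - 2b.
-- For (iv), the digits of s n at places 0..K determine n + K modulo 2^(K+1), one place at a
-- time: adding 1 to n + k modulo 2^(k+1) gives n + k + 1 modulo 2^(k+1), and the next digit
-- extends this to modulo 2^(k+2). For K large this residue is n + K itself.
module Submission where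

open import Algebra.Core using (Op₂)
open import Algebra.Structures using (IsMonoid)
open import Data.Bool using (true; false; if_then_else_)
import Data.Integer as ℤ
import Data.Integer.Properties as ℤP
import Data.Integer.Tactic.RingSolver as ℤ-Solver
open import Data.List using (foldr; map; upTo; applyUpTo; _∷ʳ_)
open import Data.List.Properties using (map-upTo; applyUpTo-∷ʳ; foldr-∷ʳ; foldr-fusion)
open import Data.Nat
open import Data.Nat.DivMod
open import Data.Nat.Divisibility
open import Data.Nat.Logarithm using (⌊log₂_⌋; ⌊log₂⌋-mono-≤; ⌊log₂[2^n]⌋≡n)
open import Data.Nat.Properties
open import Data.Nat.Tactic.RingSolver using (solve-∀)
open import Data.Product using (_×_; _,_)
open import Data.Sum using (_⊎_; inj₁; inj₂)
open import Function.Bundles using (mk⇔)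
open import Function.Definitions using (Injective)
open import Relation.Binary.PropositionalEquality
open import Relation.Nullary using (¬_; yes; no; contradiction)
open import Relation.Nullary.Decidable using (does; dec-true; dec-false; does-⇔)
open ≡-Reasoning

open import Defs

module _ {A : Set} {_∙_ : Op₂ A} {ε : A} (isMonoid : IsMonoid _≡_ _∙_ ε) where
  open IsMonoid isMonoid using (assoc; identityˡ; identityʳ)

  foldr-map-upTo-suc : ∀ (f : ℕ → A) N →
    foldr _∙_ ε (map f (upTo (suc N))) ≡ foldr _∙_ ε (map f (upTo N)) ∙ f N
  foldr-map-upTo-suc f N = begin
    foldr _∙_ ε (map f (upTo (suc N)))         ≡⟨ cong (foldr _∙_ ε) (map-upTo f (suc N)) ⟩
    foldr _∙_ ε (applyUpTo f (suc N))          ≡⟨ cong (foldr _∙_ ε) (applyUpTo-∷ʳ f N) ⟨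
    foldr _∙_ ε (applyUpTo f N ∷ʳ f N)         ≡⟨ foldr-∷ʳ _∙_ ε (f N) (applyUpTo f N) ⟩
    foldr _∙_ (f N ∙ ε) (applyUpTo f N)        ≡⟨ cong (λ e → foldr _∙_ e (applyUpTo f N)) f[N]∙ε≡ε∙f[N] ⟩
    foldr _∙_ (ε ∙ f N) (applyUpTo f N)        ≡⟨ foldr-fusion (_∙ f N) ε (λ x y → assoc x y (f N)) (applyUpTo f N) ⟨
    foldr _∙_ ε (applyUpTo f N) ∙ f N          ≡⟨ cong (λ xs → foldr _∙_ ε xs ∙ f N) (map-upTo f N) ⟨
    foldr _∙_ ε (map f (upTo N)) ∙ f N         ∎
    where
    f[N]∙ε≡ε∙f[N] : f N ∙ ε ≡ ε ∙ f N
    f[N]∙ε≡ε∙f[N] = trans (identityʳ (f N)) (sym (identityˡ (f N)))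

Σ<ℕ-suc : ∀ f N → Σ<ℕ (suc N) f ≡ Σ<ℕ N f + f N
Σ<ℕ-suc = foldr-map-upTo-suc +-0-isMonoid

Σ<ℤ-suc : ∀ f N → Σ<ℤ (suc N) f ≡ Σ<ℤ N f ℤ.+ f N
Σ<ℤ-suc = foldr-map-upTo-suc ℤP.+-0-isMonoid

Σ<ℕ-cong : ∀ N {f g} → (∀ k → k < N → f k ≡ g k) → Σ<ℕ N f ≡ Σ<ℕ N g
Σ<ℕ-cong zero    f≗g = refl
Σ<ℕ-cong (suc N) {f} {g} f≗g = begin
  Σ<ℕ (suc N) f  ≡⟨ Σ<ℕ-suc f N ⟩
  Σ<ℕ N f + f N  ≡⟨ cong₂ _+_ (Σ<ℕ-cong N (λ k k<N → f≗g k (m<n⇒m<1+n k<N))) (f≗g N ≤-refl) ⟩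
  Σ<ℕ N g + g N  ≡⟨ Σ<ℕ-suc g N ⟨
  Σ<ℕ (suc N) g  ∎

Σ<ℕ-tail : ∀ {M} N {f} → (∀ k → M ≤ k → f k ≡ 0) → M ≤ N → Σ<ℕ N f ≡ Σ<ℕ M f
Σ<ℕ-tail zero    vanish z≤n = refl
Σ<ℕ-tail {M} (suc N) {f} vanish M≤1+N with m≤n⇒m<n∨m≡n M≤1+N
... | inj₂ refl = refl
... | inj₁ M<1+N = begin
  Σ<ℕ (suc N) f  ≡⟨ Σ<ℕ-suc f N ⟩
  Σ<ℕ N f + f N  ≡⟨ cong₂ _+_ (Σ<ℕ-tail N vanish M≤N) (vanish N M≤N) ⟩
  Σ<ℕ M f + 0    ≡⟨ +-identityʳ _ ⟩
  Σ<ℕ M f        ∎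
  where M≤N = s≤s⁻¹ M<1+N

2^n+2^n≤2^[1+n] : ∀ n → 2 ^ n + 2 ^ n ≤ 2 ^ suc n
2^n+2^n≤2^[1+n] n = ≤-reflexive (cong (2 ^ n +_) (sym (+-identityʳ (2 ^ n))))

m<2^n⇒1+m<2^[1+n] : ∀ {m} n → m < 2 ^ n → suc m < 2 ^ suc n
m<2^n⇒1+m<2^[1+n] n m<2^n = <-≤-trans (+-mono-≤-< (m^n>0 2 n) m<2^n) (2^n+2^n≤2^[1+n] n)

n<2^n : ∀ n → n < 2 ^ n
n<2^n zero    = z<s
n<2^n (suc n) = m<2^n⇒1+m<2^[1+n] n (n<2^n n)

n<2^[1+n] : ∀ n → n < 2 ^ suc n
n<2^[1+n] n = <-trans (n<1+n n) (n<2^n (suc n))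

m<2^n⇒2^n+m<2^[1+n] : ∀ n {m} → m < 2 ^ n → 2 ^ n + m < 2 ^ suc n
m<2^n⇒2^n+m<2^[1+n] n m<2^n = <-≤-trans (+-monoʳ-< (2 ^ n) m<2^n) (2^n+2^n≤2^[1+n] n)

n<2^m∧m<k⇒n+k<2^k : ∀ {n m} k → n < 2 ^ m → m < k → n + k < 2 ^ k
n<2^m∧m<k⇒n+k<2^k {n} {m} (suc k) n<2^m (s≤s m≤k) with m≤n⇒m<n∨m≡n m≤k
... | inj₁ m<k  = subst (_< 2 ^ suc k) (sym (+-suc n k)) (m<2^n⇒1+m<2^[1+n] k (n<2^m∧m<k⇒n+k<2^k k n<2^m m<k))
... | inj₂ refl = <-≤-trans (+-mono-<-≤ n<2^m (n<2^n m)) (2^n+2^n≤2^[1+n] m)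

m≤n⇒2^m∣2^n : ∀ {m n} → m ≤ n → 2 ^ m ∣ 2 ^ n
m≤n⇒2^m∣2^n {m} {n} m≤n = divides (2 ^ (n ∸ m)) (begin
  2 ^ n                ≡⟨ cong (2 ^_) (m∸n+n≡m m≤n) ⟨
  2 ^ (n ∸ m + m)      ≡⟨ ^-distribˡ-+-* 2 (n ∸ m) m ⟩
  2 ^ (n ∸ m) * 2 ^ m  ∎)

⌊log₂n⌋<m⇒n<2^m : ∀ n {m} → ⌊log₂ n ⌋ < m → n < 2 ^ m
⌊log₂n⌋<m⇒n<2^m n {m} log<m with n <? 2 ^ m
... | yes n<2^m = n<2^m
... | no  n≮2^m = contradiction log<m (≤⇒≯ m≤log)
  where
  m≤log : m ≤ ⌊log₂ n ⌋
  m≤log = subst (_≤ ⌊log₂ n ⌋) (⌊log₂[2^n]⌋≡n m) (⌊log₂⌋-mono-≤ (≮⇒≥ n≮2^m))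

m∣n∧0<n<2*m⇒n≡m : ∀ {m n} → m ∣ n → 0 < n → n < 2 * m → n ≡ m
m∣n∧0<n<2*m⇒n≡m (divides zero          refl) ()
m∣n∧0<n<2*m⇒n≡m (divides (suc zero)    refl) _ _ = +-identityʳ _
m∣n∧0<n<2*m⇒n≡m {m} (divides (suc (suc q)) refl) _ n<2m =
  contradiction n<2m (≤⇒≯ (+-monoʳ-≤ m (+-monoʳ-≤ m z≤n)))

m+n≡o⇒m≡o∸n : ∀ {m n o} → m + n ≡ o → m ≡ o ∸ n
m+n≡o⇒m≡o∸n {m} {n} m+n≡o = trans (sym (m+n∸n≡m m n)) (cong (_∸ n) m+n≡o)

m≡o∸n⇒m+n≡o : ∀ {m n o} → n ≤ o → m ≡ o ∸ n → m + n ≡ o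
m≡o∸n⇒m+n≡o n≤o refl = m∸n+n≡m n≤o

[1+x]/d≡x/d+[d∣1+x] : ∀ x d .{{_ : NonZero d}} → suc x / d ≡ x / d + (if does (d ∣? suc x) then 1 else 0)
[1+x]/d≡x/d+[d∣1+x] x d = by-last-digit (m≤n⇒m<n∨m≡n (m%n<n x d))
  where
  q = x / d
  r = x % d
  suc-x≡ : suc x ≡ suc r + q * d
  suc-x≡ = cong suc (m≡m%n+[m/n]*n x d)
  quot : suc x / d ≡ suc r / d + q
  quot = begin
    suc x / d              ≡⟨ /-congˡ suc-x≡ ⟩
    (suc r + q * d) / d    ≡⟨ +-distrib-/-∣ʳ (suc r) (n∣m*n q) ⟩
    suc r / d + q * d / d  ≡⟨ cong (suc r / d +_) (m*n/n≡m q d) ⟩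
    suc r / d + q          ∎
  rem : suc x % d ≡ suc r % d
  rem = trans (%-congˡ suc-x≡) ([m+kn]%n≡m%n (suc r) q d)
  by-last-digit : suc r < d ⊎ suc r ≡ d → suc x / d ≡ q + (if does (d ∣? suc x) then 1 else 0)
  by-last-digit (inj₁ 1+r<d) = begin
    suc x / d      ≡⟨ quot ⟩
    suc r / d + q  ≡⟨ cong (_+ q) (m<n⇒m/n≡0 1+r<d) ⟩
    q              ≡⟨ +-identityʳ q ⟨
    q + 0          ≡⟨ cong (λ b → q + (if b then 1 else 0)) (dec-false (d ∣? suc x) d∤1+x) ⟨
    q + _          ∎
    where
    d∤1+x : ¬ d ∣ suc x
    d∤1+x d∣1+x = 1+n≢0 (trans (sym (trans rem (m<n⇒m%n≡m 1+r<d))) (n∣m⇒m%n≡0 _ _ d∣1+x))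
  by-last-digit (inj₂ 1+r≡d) = begin
    suc x / d      ≡⟨ quot ⟩
    suc r / d + q  ≡⟨ cong (_+ q) (trans (/-congˡ 1+r≡d) (n/n≡1 d)) ⟩
    1 + q          ≡⟨ +-comm 1 q ⟩
    q + 1          ≡⟨ cong (λ b → q + (if b then 1 else 0)) (dec-true (d ∣? suc x) d∣1+x) ⟨
    q + _          ∎
    where
    d∣1+x : d ∣ suc x
    d∣1+x = m%n≡0⇒n∣m _ _ (trans rem (trans (%-congˡ 1+r≡d) (n%n≡0 d)))

_%2^_ : ℕ → ℕ → ℕ
m %2^ k = _%_ m (2 ^ k) {{m^n≢0 2 k}}

%2^-suc : ∀ x k → x %2^ suc k ≡ x %2^ k + bit k x * 2 ^ k
%2^-suc x k = begin
  y                              ≡⟨ m≡m%n+[m/n]*n y (2 ^ k) ⟩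
  y % 2 ^ k + y / 2 ^ k * 2 ^ k  ≡⟨ cong₂ (λ u v → u + v * 2 ^ k) y%2^k≡x%2^k (m%[n*o]/o≡m/o%n x 2 (2 ^ k)) ⟩
  x % 2 ^ k + bit k x * 2 ^ k    ∎
  where
  instance
    2^k≢0   = m^n≢0 2 k
    2^1+k≢0 = m^n≢0 2 (suc k)
  y = x % 2 ^ suc k
  y%2^k≡x%2^k : y % 2 ^ k ≡ x % 2 ^ k
  y%2^k≡x%2^k = m∣n⇒o%n%m≡o%m (2 ^ k) (2 ^ suc k) x (m≤n⇒2^m∣2^n (n≤1+n k))

binary-sum<2^N : ∀ N {b : ℕ → ℕ} → (∀ k → b k ≤ 1) → Σ<ℕ N (λ k → b k * 2 ^ k) < 2 ^ N
binary-sum<2^N zero    b≤1 = z<s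
binary-sum<2^N (suc N) {b} b≤1 = subst (_< 2 ^ suc N) (sym (Σ<ℕ-suc (λ k → b k * 2 ^ k) N))
  (<-≤-trans (+-mono-<-≤ (binary-sum<2^N N b≤1) top-digit≤2^N) (2^n+2^n≤2^[1+n] N))
  where
  top-digit≤2^N : b N * 2 ^ N ≤ 2 ^ N
  top-digit≤2^N = ≤-trans (*-monoˡ-≤ (2 ^ N) (b≤1 N)) (≤-reflexive (*-identityˡ (2 ^ N)))

binary-digits-unique : ∀ N {b c : ℕ → ℕ} → (∀ k → b k ≤ 1) → (∀ k → c k ≤ 1) →
  Σ<ℕ N (λ k → b k * 2 ^ k) ≡ Σ<ℕ N (λ k → c k * 2 ^ k) → ∀ k → k < N → b k ≡ c k
binary-digits-unique (suc N) {b} {c} b≤1 c≤1 eq k k<1+N = by-position (m≤n⇒m<n∨m≡n (s≤s⁻¹ k<1+N))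
  where
  instance _ = m^n≢0 2 N
  B = Σ<ℕ N (λ k → b k * 2 ^ k)
  C = Σ<ℕ N (λ k → c k * 2 ^ k)
  eq′ : B + b N * 2 ^ N ≡ C + c N * 2 ^ N
  eq′ = trans (sym (Σ<ℕ-suc (λ k → b k * 2 ^ k) N)) (trans eq (Σ<ℕ-suc (λ k → c k * 2 ^ k) N))
  drop-top : ∀ {x} d → x < 2 ^ N → (x + d * 2 ^ N) % 2 ^ N ≡ x
  drop-top {x} d x<2^N = trans ([m+kn]%n≡m%n x d (2 ^ N)) (m<n⇒m%n≡m x<2^N)
  B≡C : B ≡ C
  B≡C = trans (sym (drop-top (b N) (binary-sum<2^N N b≤1))) (trans (%-congˡ eq′) (drop-top (c N) (binary-sum<2^N N c≤1)))
  top-equal : b N ≡ c N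
  top-equal = *-cancelʳ-≡ _ _ (2 ^ N) (+-cancelˡ-≡ B _ _ (trans eq′ (cong (_+ c N * 2 ^ N) (sym B≡C))))
  by-position : k < N ⊎ k ≡ N → b k ≡ c k
  by-position (inj₁ k<N)  = binary-digits-unique N b≤1 c≤1 B≡C k k<N
  by-position (inj₂ refl) = top-equal

negOnePow≡1-2*parity : ∀ x → negOnePow x ≡ ℤ.+ 1 ℤ.- ℤ.+ (2 * (x % 2))
negOnePow≡1-2*parity x = by-parity (x % 2) (m%n<n x 2)
  where
  by-parity : ∀ r → r < 2 → (if does (r ≟ 0) then ℤ.+ 1 else ℤ.- ℤ.+ 1) ≡ ℤ.+ 1 ℤ.- ℤ.+ (2 * r)
  by-parity 0 _ = refl
  by-parity 1 _ = refl
  by-parity (suc (suc r)) (s≤s (s≤s ()))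

signed-binary-sum : ∀ (b : ℕ → ℕ) N →
  Σ<ℤ N (λ k → negOnePow (b k) ℤ.* ℤ.+ (2 ^ k))
    ≡ (ℤ.+ (2 ^ N) ℤ.- ℤ.+ 1) ℤ.- ℤ.+ (2 * Σ<ℕ N (λ k → b k % 2 * 2 ^ k))
signed-binary-sum b zero    = refl
signed-binary-sum b (suc N) = begin
  Σ<ℤ (suc N) F                                                    ≡⟨ Σ<ℤ-suc F N ⟩
  Σ<ℤ N F ℤ.+ negOnePow (b N) ℤ.* ℤ.+ P
    ≡⟨ cong₂ (λ u v → u ℤ.+ v ℤ.* ℤ.+ P) (signed-binary-sum b N) (negOnePow≡1-2*parity (b N)) ⟩
  ((ℤ.+ P ℤ.- ℤ.+ 1) ℤ.- ℤ.+ (2 * T)) ℤ.+ (ℤ.+ 1 ℤ.- ℤ.+ (2 * B)) ℤ.* ℤ.+ P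
    ≡⟨ cong₂ (λ u v → ((ℤ.+ P ℤ.- ℤ.+ 1) ℤ.- u) ℤ.+ (ℤ.+ 1 ℤ.- v) ℤ.* ℤ.+ P) (ℤP.pos-* 2 T) (ℤP.pos-* 2 B) ⟩
  ((ℤ.+ P ℤ.- ℤ.+ 1) ℤ.- ℤ.+ 2 ℤ.* ℤ.+ T) ℤ.+ (ℤ.+ 1 ℤ.- ℤ.+ 2 ℤ.* ℤ.+ B) ℤ.* ℤ.+ P ≡⟨ regroup (ℤ.+ P) (ℤ.+ T) (ℤ.+ B) ⟩
  (ℤ.+ 2 ℤ.* ℤ.+ P ℤ.- ℤ.+ 1) ℤ.- ℤ.+ 2 ℤ.* (ℤ.+ T ℤ.+ ℤ.+ B ℤ.* ℤ.+ P)
    ≡⟨ cong₂ (λ u v → (u ℤ.- ℤ.+ 1) ℤ.- v) (ℤP.pos-* 2 P) 2[T+BP]-cast ⟨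
  (ℤ.+ (2 * P) ℤ.- ℤ.+ 1) ℤ.- ℤ.+ (2 * (T + B * P))
    ≡⟨ cong (λ t → (ℤ.+ (2 * P) ℤ.- ℤ.+ 1) ℤ.- ℤ.+ (2 * t)) (Σ<ℕ-suc (λ k → b k % 2 * 2 ^ k) N) ⟨
  (ℤ.+ (2 * P) ℤ.- ℤ.+ 1) ℤ.- ℤ.+ (2 * Σ<ℕ (suc N) (λ k → b k % 2 * 2 ^ k)) ∎
  where
  F = λ k → negOnePow (b k) ℤ.* ℤ.+ (2 ^ k)
  P = 2 ^ N
  T = Σ<ℕ N (λ k → b k % 2 * 2 ^ k)
  B = b N % 2
  2[T+BP]-cast : ℤ.+ (2 * (T + B * P)) ≡ ℤ.+ 2 ℤ.* (ℤ.+ T ℤ.+ ℤ.+ B ℤ.* ℤ.+ P)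
  2[T+BP]-cast = trans (ℤP.pos-* 2 (T + B * P)) (cong (ℤ.+ 2 ℤ.*_) (trans (ℤP.pos-+ T (B * P)) (cong (λ z → ℤ.+ T ℤ.+ z) (ℤP.pos-* B P))))
  regroup : ∀ p t b → ((p ℤ.- ℤ.+ 1) ℤ.- ℤ.+ 2 ℤ.* t) ℤ.+ (ℤ.+ 1 ℤ.- ℤ.+ 2 ℤ.* b) ℤ.* p
                    ≡ (ℤ.+ 2 ℤ.* p ℤ.- ℤ.+ 1) ℤ.- ℤ.+ 2 ℤ.* (t ℤ.+ b ℤ.* p)
  regroup = ℤ-Solver.solve-∀

diag : ℕ → ℕ → ℕ
diag n k = (n + k) /2^ k

sPartial : ℕ → ℕ → ℕ
sPartial n N = Σ<ℕ N (λ k → bit k (n + k) * 2 ^ k)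

-- The summands of divSum, which Defs keeps local to its definition.
divTerm : ℕ → ℕ → ℕ
divTerm n zero    = 0
divTerm n (suc k) = if does (2 ^ suc k ∣? n + suc k) then 2 ^ suc k else 0

divTerm-suc : ∀ n k → divTerm n (suc k) ≡ (if does (2 ^ suc k ∣? n + suc k) then 1 else 0) * 2 ^ suc k
divTerm-suc n k with does (2 ^ suc k ∣? n + suc k)
... | true  = sym (+-identityʳ _)
... | false = refl

divTerm-∣ : ∀ {n k} → 2 ^ suc k ∣ n + suc k → divTerm n (suc k) ≡ 2 ^ suc k
divTerm-∣ {n} {k} ∣ = cong (λ b → if b then 2 ^ suc k else 0) (dec-true (2 ^ suc k ∣? n + suc k) ∣)

divTerm-∤ : ∀ {n k} → ¬ 2 ^ suc k ∣ n + suc k → divTerm n (suc k) ≡ 0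
divTerm-∤ {n} {k} ∤ = cong (λ b → if b then 2 ^ suc k else 0) (dec-false (2 ^ suc k ∣? n + suc k) ∤)

diag-suc : ∀ n k → diag n (suc k) ≡ diag n k / 2 + (if does (2 ^ suc k ∣? n + suc k) then 1 else 0)
diag-suc n k rewrite +-suc n k = begin
  suc (n + k) / 2 ^ suc k                       ≡⟨ [1+x]/d≡x/d+[d∣1+x] (n + k) (2 ^ suc k) ⟩
  (n + k) / 2 ^ suc k + carry                   ≡⟨ cong (_+ carry) (/-congʳ (*-comm 2 (2 ^ k))) ⟩
  (n + k) / (2 ^ k * 2) + carry                 ≡⟨ cong (_+ carry) (m/n/o≡m/[n*o] (n + k) (2 ^ k) 2) ⟨
  (n + k) / 2 ^ k / 2 + carry                   ∎
  where
  instance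
    2^k≢0    = m^n≢0 2 k
    2^1+k≢0  = m^n≢0 2 (suc k)
    2^k*2≢0  = m*n≢0 (2 ^ k) 2
  carry = if does (2 ^ suc k ∣? suc (n + k)) then 1 else 0

sPartial-telescope : ∀ n N → sPartial n N + diag n N * 2 ^ N ≡ n + Σ<ℕ (suc N) (divTerm n)
sPartial-telescope n zero    = trans (*-identityʳ _) (n/1≡n (n + 0))
sPartial-telescope n (suc N) = begin
  sPartial n (suc N) + diag n (suc N) * (2 * P)      ≡⟨ cong₂ (λ u v → u + v * (2 * P)) (Σ<ℕ-suc _ N) (diag-suc n N) ⟩
  (sPartial n N + D % 2 * P) + (D / 2 + c) * (2 * P) ≡⟨ regroup (sPartial n N) (D % 2) (D / 2) c P ⟩
  (sPartial n N + (D % 2 + D / 2 * 2) * P) + c * (2 * P)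
    ≡⟨ cong (λ z → (sPartial n N + z * P) + c * (2 * P)) (m≡m%n+[m/n]*n D 2) ⟨
  (sPartial n N + D * P) + c * (2 * P)               ≡⟨ cong₂ _+_ (sPartial-telescope n N) (sym (divTerm-suc n N)) ⟩
  (n + Σ<ℕ (suc N) (divTerm n)) + divTerm n (suc N)  ≡⟨ +-assoc n _ _ ⟩
  n + (Σ<ℕ (suc N) (divTerm n) + divTerm n (suc N))  ≡⟨ cong (n +_) (Σ<ℕ-suc (divTerm n) (suc N)) ⟨
  n + Σ<ℕ (suc (suc N)) (divTerm n)                  ∎
  where
  P = 2 ^ N
  D = diag n N
  c = if does (2 ^ suc N ∣? n + suc N) then 1 else 0
  regroup : ∀ S r q c P → (S + r * P) + (q + c) * (2 * P) ≡ (S + (r + q * 2) * P) + c * (2 * P)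
  regroup = solve-∀

diag-vanishes : ∀ {n m} k → n < 2 ^ m → m < k → diag n k ≡ 0
diag-vanishes k n<2^m m<k = m<n⇒m/n≡0 {{m^n≢0 2 k}} (n<2^m∧m<k⇒n+k<2^k k n<2^m m<k)

divTerm-vanishes : ∀ {n m} k → n < 2 ^ m → m < suc k → divTerm n (suc k) ≡ 0
divTerm-vanishes {n} k n<2^m m<1+k = divTerm-∤ (>⇒∤ {{>-nonZero 0<n+1+k}} (n<2^m∧m<k⇒n+k<2^k (suc k) n<2^m m<1+k))
  where
  0<n+1+k : 0 < n + suc k
  0<n+1+k = <-≤-trans 0<1+n (m≤n+m (suc k) n)

sPartial-stable : ∀ {n m M} → n < 2 ^ m → m ≤ M → sPartial n (suc M) ≡ sPartial n (suc m)
sPartial-stable {n} {M = M} n<2^m m≤M =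
  Σ<ℕ-tail (suc M) (λ k m<k → cong (λ d → d % 2 * 2 ^ k) (diag-vanishes k n<2^m m<k)) (s≤s m≤M)

s≡sPartial : ∀ {n} m → n < 2 ^ m → s n ≡ sPartial n (suc m)
s≡sPartial {n} m n<2^m = begin
  s n                            ≡⟨ cong (sPartial n) (+-comm n 2) ⟩
  sPartial n (suc (suc n))       ≡⟨ sPartial-stable (n<2^[1+n] n) (m≤n⊔m m (suc n)) ⟨
  sPartial n (suc (m ⊔ suc n))   ≡⟨ sPartial-stable n<2^m (m≤m⊔n m (suc n)) ⟩
  sPartial n (suc m)             ∎

s≡n+Σ<divTerm : ∀ {n} m → n < 2 ^ m → s n ≡ n + Σ<ℕ (suc m) (divTerm n)
s≡n+Σ<divTerm {n} m n<2^m = begin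
  s n                                                  ≡⟨ s≡sPartial m n<2^m ⟩
  sPartial n (suc m)                                   ≡⟨ +-identityʳ _ ⟨
  sPartial n (suc m) + 0                               ≡⟨ cong (λ d → sPartial n (suc m) + d * 2 ^ suc m) (diag-vanishes (suc m) n<2^m ≤-refl) ⟨
  sPartial n (suc m) + diag n (suc m) * 2 ^ suc m      ≡⟨ sPartial-telescope n (suc m) ⟩
  n + Σ<ℕ (suc (suc m)) (divTerm n)                    ≡⟨ cong (n +_) (Σ<ℕ-suc (divTerm n) (suc m)) ⟩
  n + (Σ<ℕ (suc m) (divTerm n) + divTerm n (suc m))    ≡⟨ cong (λ t → n + (Σ<ℕ (suc m) (divTerm n) + t)) (divTerm-vanishes m n<2^m ≤-refl) ⟩
  n + (Σ<ℕ (suc m) (divTerm n) + 0)                    ≡⟨ cong (n +_) (+-identityʳ _) ⟩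
  n + Σ<ℕ (suc m) (divTerm n)                          ∎

divSum≡Σ<divTerm : ∀ n → divSum n ≡ Σ<ℕ (n + 2) (divTerm n)
divSum≡Σ<divTerm n = Σ<ℕ-cong (n + 2) λ { zero _ → refl ; (suc k) _ → refl }

s≡n+divSum : ∀ n → s n ≡ n + divSum n
s≡n+divSum n = begin
  s n                                ≡⟨ s≡n+Σ<divTerm (suc n) (n<2^[1+n] n) ⟩
  n + Σ<ℕ (suc (suc n)) (divTerm n)  ≡⟨ cong (λ N → n + Σ<ℕ N (divTerm n)) (+-comm n 2) ⟨
  n + Σ<ℕ (n + 2) (divTerm n)        ≡⟨ cong (n +_) (divSum≡Σ<divTerm n) ⟨
  n + divSum n                       ∎

divTerm-+-multiple : ∀ {a} j k → 2 ^ k ∣ a → divTerm (a + j) k ≡ divTerm j k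
divTerm-+-multiple j zero    _  = refl
divTerm-+-multiple {a} j (suc k) 2^k∣a =
  cong (λ b → if b then 2 ^ suc k else 0) (does-⇔ (mk⇔ drop-a add-a) (2 ^ suc k ∣? a + j + suc k) (2 ^ suc k ∣? j + suc k))
  where
  drop-a : 2 ^ suc k ∣ a + j + suc k → 2 ^ suc k ∣ j + suc k
  drop-a ∣a+j+k = ∣m+n∣m⇒∣n (subst (2 ^ suc k ∣_) (+-assoc a j (suc k)) ∣a+j+k) 2^k∣a
  add-a : 2 ^ suc k ∣ j + suc k → 2 ^ suc k ∣ a + j + suc k
  add-a ∣j+k = subst (2 ^ suc k ∣_) (sym (+-assoc a j (suc k))) (∣m∣n⇒∣m+n 2^k∣a ∣j+k)

divTerm-[2^i+j]-hit : ∀ i {j} → j + suc i ≡ 2 ^ i → divTerm (2 ^ i + j) (suc i) ≡ 2 ^ suc i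
divTerm-[2^i+j]-hit i {j} j+1+i≡2^i = divTerm-∣ (∣-reflexive (sym (begin
  2 ^ i + j + suc i    ≡⟨ +-assoc (2 ^ i) j (suc i) ⟩
  2 ^ i + (j + suc i)  ≡⟨ cong (2 ^ i +_) (trans j+1+i≡2^i (sym (+-identityʳ (2 ^ i)))) ⟩
  2 ^ suc i            ∎)))

divTerm-[2^i+j]-miss : ∀ i {j} → j < 2 ^ i → j + suc i ≢ 2 ^ i → divTerm (2 ^ i + j) (suc i) ≡ 0
divTerm-[2^i+j]-miss i {j} j<2^i j+1+i≢2^i = divTerm-∤ λ ∣X → j+1+i≢2^i (begin
  j + suc i   ≡⟨ +-cancelˡ-≡ (2 ^ i) _ _ (trans (sym (+-assoc (2 ^ i) j (suc i))) (m∣n∧0<n<2*m⇒n≡m ∣X 0<X X<2*2^[1+i])) ⟩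
  2 ^ i + 0   ≡⟨ +-identityʳ (2 ^ i) ⟩
  2 ^ i       ∎)
  where
  X = 2 ^ i + j + suc i
  0<X : 0 < X
  0<X = <-≤-trans 0<1+n (m≤n+m (suc i) (2 ^ i + j))
  X<2*2^[1+i] : X < 2 ^ suc (suc i)
  X<2*2^[1+i] = <-trans (+-monoʳ-< (2 ^ i + j) (n<1+n (suc i)))
                        (n<2^m∧m<k⇒n+k<2^k (suc (suc i)) (m<2^n⇒2^n+m<2^[1+n] i j<2^i) (n<1+n (suc i)))

s[2^i+j] : ∀ i {j} → j < 2 ^ i → s (2 ^ i + j) ≡ 2 ^ i + s j + divTerm (2 ^ i + j) (suc i)
s[2^i+j] i {j} j<2^i = begin
  s (2 ^ i + j)                                     ≡⟨ s≡n+Σ<divTerm (suc i) (m<2^n⇒2^n+m<2^[1+n] i j<2^i) ⟩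
  2 ^ i + j + Σ<ℕ (suc (suc i)) (divTerm (2 ^ i + j))  ≡⟨ cong (2 ^ i + j +_) (Σ<ℕ-suc (divTerm (2 ^ i + j)) (suc i)) ⟩
  2 ^ i + j + (Σ<ℕ (suc i) (divTerm (2 ^ i + j)) + T)  ≡⟨ cong (λ Σ → 2 ^ i + j + (Σ + T)) (Σ<ℕ-cong (suc i) low-terms-agree) ⟩
  2 ^ i + j + (Σ<ℕ (suc i) (divTerm j) + T)         ≡⟨ regroup (2 ^ i) j _ T ⟩
  2 ^ i + (j + Σ<ℕ (suc i) (divTerm j)) + T         ≡⟨ cong (λ x → 2 ^ i + x + T) (s≡n+Σ<divTerm i j<2^i) ⟨
  2 ^ i + s j + T                                   ∎
  where
  T = divTerm (2 ^ i + j) (suc i)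
  low-terms-agree : ∀ k → k < suc i → divTerm (2 ^ i + j) k ≡ divTerm j k
  low-terms-agree k k<1+i = divTerm-+-multiple j k (m≤n⇒2^m∣2^n (s≤s⁻¹ k<1+i))
  regroup : ∀ P j Σ T → P + j + (Σ + T) ≡ P + (j + Σ) + T
  regroup = solve-∀

s[2^i+j]-cases : ∀ i j → j ≤ 2 ^ i ∸ 1 →
                 (j ≢ 2 ^ i ∸ i ∸ 1 → s (2 ^ i + j) ≡ 2 ^ i + s j)
               × (j ≡ 2 ^ i ∸ i ∸ 1 → s (2 ^ i + j) ≡ 3 * 2 ^ i + s j)
s[2^i+j]-cases i j j≤2^i∸1 = generic , exceptional
  where
  j<2^i : j < 2 ^ i
  j<2^i = m≤pred[n]⇒suc[m]≤n {{m^n≢0 2 i}} j≤2^i∸1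
  2^i∸i∸1≡2^i∸[1+i] : 2 ^ i ∸ i ∸ 1 ≡ 2 ^ i ∸ suc i
  2^i∸i∸1≡2^i∸[1+i] = trans (∸-+-assoc (2 ^ i) i 1) (cong (2 ^ i ∸_) (+-comm i 1))
  generic : j ≢ 2 ^ i ∸ i ∸ 1 → s (2 ^ i + j) ≡ 2 ^ i + s j
  generic j≢ = begin
    s (2 ^ i + j)                                 ≡⟨ s[2^i+j] i j<2^i ⟩
    2 ^ i + s j + divTerm (2 ^ i + j) (suc i)     ≡⟨ cong (2 ^ i + s j +_) (divTerm-[2^i+j]-miss i j<2^i j+1+i≢2^i) ⟩
    2 ^ i + s j + 0                               ≡⟨ +-identityʳ _ ⟩
    2 ^ i + s j                                   ∎
    where
    j+1+i≢2^i : j + suc i ≢ 2 ^ i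
    j+1+i≢2^i eq = j≢ (trans (m+n≡o⇒m≡o∸n eq) (sym 2^i∸i∸1≡2^i∸[1+i]))
  exceptional : j ≡ 2 ^ i ∸ i ∸ 1 → s (2 ^ i + j) ≡ 3 * 2 ^ i + s j
  exceptional j≡ = begin
    s (2 ^ i + j)                                 ≡⟨ s[2^i+j] i j<2^i ⟩
    2 ^ i + s j + divTerm (2 ^ i + j) (suc i)     ≡⟨ cong (2 ^ i + s j +_) (divTerm-[2^i+j]-hit i j+1+i≡2^i) ⟩
    2 ^ i + s j + 2 * 2 ^ i                       ≡⟨ regroup (2 ^ i) (s j) ⟩
    3 * 2 ^ i + s j                               ∎
    where
    j+1+i≡2^i : j + suc i ≡ 2 ^ i
    j+1+i≡2^i = m≡o∸n⇒m+n≡o (n<2^n i) (trans j≡ 2^i∸i∸1≡2^i∸[1+i])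
    regroup : ∀ P x → P + x + 2 * P ≡ 3 * P + x
    regroup = solve-∀

diagonal-bits-determine-residue : ∀ {x y} K → (∀ k → k ≤ K → bit k (x + k) ≡ bit k (y + k)) →
                                  (x + K) %2^ suc K ≡ (y + K) %2^ suc K
diagonal-bits-determine-residue {x} {y} zero bits-agree = begin
  (x + 0) % 2            ≡⟨ cong (_% 2) (n/1≡n (x + 0)) ⟨
  bit 0 (x + 0)          ≡⟨ bits-agree 0 z≤n ⟩
  bit 0 (y + 0)          ≡⟨ cong (_% 2) (n/1≡n (y + 0)) ⟩
  (y + 0) % 2            ∎
diagonal-bits-determine-residue {x} {y} (suc K) bits-agree = begin
  (x + suc K) %2^ suc (suc K)                                   ≡⟨ %2^-suc (x + suc K) (suc K) ⟩
  (x + suc K) %2^ suc K + bit (suc K) (x + suc K) * 2 ^ suc K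
    ≡⟨ cong₂ (λ r t → r + t * 2 ^ suc K) lower-residues-agree (bits-agree (suc K) ≤-refl) ⟩
  (y + suc K) %2^ suc K + bit (suc K) (y + suc K) * 2 ^ suc K   ≡⟨ %2^-suc (y + suc K) (suc K) ⟨
  (y + suc K) %2^ suc (suc K)                                   ∎
  where
  instance _ = m^n≢0 2 (suc K)
  previous : (x + K) %2^ suc K ≡ (y + K) %2^ suc K
  previous = diagonal-bits-determine-residue K (λ k k≤K → bits-agree k (m≤n⇒m≤1+n k≤K))
  step : ∀ z → (z + suc K) %2^ suc K ≡ (1 % 2 ^ suc K + (z + K) %2^ suc K) % 2 ^ suc K
  step z = trans (%-congˡ (+-suc z K)) (%-distribˡ-+ 1 (z + K) (2 ^ suc K))
  lower-residues-agree : (x + suc K) %2^ suc K ≡ (y + suc K) %2^ suc K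
  lower-residues-agree = trans (step x) (trans (cong (λ r → (1 % 2 ^ suc K + r) % 2 ^ suc K) previous) (sym (step y)))

s-injective : Injective _≡_ _≡_ s
s-injective {n} {n′} sn≡sn′ = +-cancelʳ-≡ m n n′ (begin
  n + m                  ≡⟨ m<n⇒m%n≡m (x+m<2^[1+m] n<2^m) ⟨
  (n + m) %2^ suc m      ≡⟨ diagonal-bits-determine-residue m bits-agree ⟩
  (n′ + m) %2^ suc m     ≡⟨ m<n⇒m%n≡m (x+m<2^[1+m] n′<2^m) ⟩
  n′ + m                 ∎)
  where
  m = n + n′
  instance _ = m^n≢0 2 (suc m)
  n<2^m : n < 2 ^ m
  n<2^m = ≤-<-trans (m≤m+n n n′) (n<2^n m)
  n′<2^m : n′ < 2 ^ m
  n′<2^m = ≤-<-trans (m≤n+m n′ n) (n<2^n m)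
  x+m<2^[1+m] : ∀ {x} → x < 2 ^ m → x + m < 2 ^ suc m
  x+m<2^[1+m] {x} x<2^m = ≤-<-trans (+-monoʳ-≤ x (n≤1+n m)) (n<2^m∧m<k⇒n+k<2^k (suc m) x<2^m (n<1+n m))
  parity≤1 : ∀ x → x % 2 ≤ 1
  parity≤1 x = s≤s⁻¹ (m%n<n x 2)
  bits-agree : ∀ k → k ≤ m → bit k (n + k) ≡ bit k (n′ + k)
  bits-agree k k≤m = binary-digits-unique (suc m) (λ k → parity≤1 (diag n k)) (λ k → parity≤1 (diag n′ k))
    (trans (sym (s≡sPartial m n<2^m)) (trans sn≡sn′ (s≡sPartial m n′<2^m))) k (s≤s k≤m)

2*s≡alternating-sum : ∀ n m → ⌊log₂ n ⌋ < m →
  ℤ.+ (2 * s n) ≡ (ℤ.+ (2 * 2 ^ m) ℤ.- ℤ.+ 1) ℤ.- Σ<ℤ (suc m) (λ k → negOnePow ((n + k) /2^ k) ℤ.* ℤ.+ (2 ^ k))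
2*s≡alternating-sum n m log<m = begin
  ℤ.+ (2 * s n)                                                   ≡⟨ cong (λ t → ℤ.+ (2 * t)) (s≡sPartial m (⌊log₂n⌋<m⇒n<2^m n log<m)) ⟩
  ℤ.+ (2 * sPartial n (suc m))                                    ≡⟨ x≡y-[y-x] _ Y ⟩
  Y ℤ.- (Y ℤ.- ℤ.+ (2 * sPartial n (suc m)))                      ≡⟨ cong (λ t → Y ℤ.- t) (signed-binary-sum (diag n) (suc m)) ⟨
  Y ℤ.- Σ<ℤ (suc m) (λ k → negOnePow (diag n k) ℤ.* ℤ.+ (2 ^ k))  ∎
  where
  Y = ℤ.+ (2 * 2 ^ m) ℤ.- ℤ.+ 1
  x≡y-[y-x] : ∀ x y → x ≡ y ℤ.- (y ℤ.- x)
  x≡y-[y-x] = ℤ-Solver.solve-∀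

n≤s[n] : ∀ n → n ≤ s n
n≤s[n] n = subst (n ≤_) (sym (s≡n+divSum n)) (m≤m+n n (divSum n))

theorem1 :
    -- (i), multiplied through by 2 (to stay in ℤ)
    (∀ (n m : ℕ) → 0 < n → ⌊log₂ n ⌋ < m →
       ℤ.+ (2 * s n)
         ≡ (ℤ.+ (2 * 2 ^ m) ℤ.- ℤ.+ 1)
           ℤ.- Σ<ℤ (suc m) (λ k → negOnePow ((n + k) /2^ k) ℤ.* ℤ.+ (2 ^ k)))
    -- (ii)
    × (s 0 ≡ 0)
    × (∀ (i j : ℕ) → j ≤ 2 ^ i ∸ 1 →
         (j ≢ 2 ^ i ∸ i ∸ 1 → s (2 ^ i + j) ≡ 2 ^ i + s j)
         × (j ≡ 2 ^ i ∸ i ∸ 1 → s (2 ^ i + j) ≡ 3 * 2 ^ i + s j))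
    -- (iii)
    × (∀ (n : ℕ) → s n ≡ n + divSum n)
    -- (iv)
    × Injective _≡_ _≡_ s
    × (∀ (n : ℕ) → n ≤ s n)
theorem1 = (λ n m _ → 2*s≡alternating-sum n m) , refl , s[2^i+j]-cases , s≡n+divSum , s-injective , n≤s[n]
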